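{- Let $d\geq 2$, $k\geq 2$ and $r\geq 2d+2$ be integers. The graph $H_{d,k,r}$ is a claw-free graph with maximum degree $r+1$ on $(r+2)k$ vertices which has no $d$-cut. Moreover, each of the vertices $w_1,\ldots,w_k$ has degree $d+2$ in $H_{d,k,r}$, and every other vertex of $H_{d,k,r}$ has degree at least $r$.
   Context: All graphs are finite, simple and undirected. The graph $H_{d,k,r}$ is constructed as follows. Take pairwise disjoint cliques $T_1,\ldots,T_k$, each on $r$ vertices, and for each $i\in\{1,\ldots,k\}$ partition $T_i$ into sets $A_i$ and $B_i$ with $|A_i|=d+1$ (so $|B_i| = r-d-1$). Add $k$ new vertices $v_1,\ldots,v_k$ such that, for each $i$, the neighbourhood of $v_i$ is exactly $B_i\cup A_{i+1}$, where $A_{k+1}:=A_1$. Then add $k$ further new vertices $w_1,\ldots,w_k$ such that, for each $i$, the neighbourhood of $w_i$ is exactly $A_i\cup\{v_{i-1}\}$, where $v_0:=v_k$. There are no other edges. A graph is claw-free if it contains no induced subgraph isomorphic to $K_{1,3}$. For an integer $d\geq 1$ and a graph $G=(V,E)$, a set $M\subseteq E$ is a $d$-cut of $G$ if $V$ can be partitioned into two non-empty sets $B$ and $R$ such that $M$ is exactly the set of edges with one end in $B$ and the other in $R$, and every vertex of $B$ has at most $d$ neighbours in $R$ and every vertex of $R$ has at most $d$ neighbours in $B$. -}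

module Defs where

open import Data.Nat using (ℕ; zero; suc; _+_; _≡ᵇ_; _<ᵇ_)
open import Data.Fin using (Fin; toℕ) renaming (zero to fzero; suc to fsuc)
open import Data.Bool using (Bool; true; false; if_then_else_; _∧_; _∨_; not; _xor_; T)
open import Data.Product using (Σ; _×_; ∃; ∃-syntax)
open import Relation.Binary.PropositionalEquality using (_≡_; _≢_)
open import Relation.Nullary using (¬_)
open import Data.Nat using (_≤_)

countFin : (n : ℕ) → (Fin n → Bool) → ℕ
countFin zero    p = 0
countFin (suc n) p = (if p fzero then 1 else 0) + countFin n (λ i → p (fsuc i))

sumFin : (n : ℕ) → (Fin n → ℕ) → ℕ
sumFin zero    f = 0
sumFin (suc n) f = f fzero + sumFin n (λ i → f (fsuc i))

-- Vertices of H_{d,k,r}: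
--   t i a : the a-th vertex of the clique T_i (i < k, a < r);
--           A_i = { t i a | a < d+1 },  B_i = { t i a | a ≥ d+1 }
--   v i, w i : the vertices v_i, w_i  (indices 0,…,k-1 instead of 1,…,k)

data V (k r : ℕ) : Set where
  t : Fin k → Fin r → V k r
  v : Fin k → V k r
  w : Fin k → V k r

countV : {k r : ℕ} → (V k r → Bool) → ℕ
countV {k} {r} p =
  sumFin k (λ i → countFin r (λ a → p (t i a)))
  + countFin k (λ i → p (v i))
  + countFin k (λ i → p (w i))

_==_ : {k : ℕ} → Fin k → Fin k → Bool
i == j = toℕ i ≡ᵇ toℕ j

nxt : (k : ℕ) → Fin k → Fin k → Bool
nxt k i j = (suc (toℕ i) ≡ᵇ toℕ j) ∨ ((suc (toℕ i) ≡ᵇ k) ∧ (toℕ j ≡ᵇ 0))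

inA : (d : ℕ) → {r : ℕ} → Fin r → Bool
inA d a = toℕ a <ᵇ suc d

adj : (d k r : ℕ) → V k r → V k r → Bool
adj d k r (t i a) (t j b) = (i == j) ∧ not (a == b)
adj d k r (v i) (t j b) = ((i == j) ∧ not (inA d b)) ∨ (nxt k i j ∧ inA d b)
adj d k r (t j b) (v i) = ((i == j) ∧ not (inA d b)) ∨ (nxt k i j ∧ inA d b)
adj d k r (w i) (t j b) = (i == j) ∧ inA d b
adj d k r (t j b) (w i) = (i == j) ∧ inA d b
adj d k r (w i) (v j) = nxt k j i
adj d k r (v j) (w i) = nxt k j i
adj d k r (v _) (v _) = false
adj d k r (w _) (w _) = false

Adj : (d k r : ℕ) → V k r → V k r → Set
Adj d k r x y = T (adj d k r x y)

deg : (d k r : ℕ) → V k r → ℕ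
deg d k r x = countV (λ u → adj d k r x u)

ClawFree : (d k r : ℕ) → Set
ClawFree d k r =
  ¬ (Σ (V k r) λ c → Σ (V k r) λ x → Σ (V k r) λ y → Σ (V k r) λ z →
       x ≢ y × x ≢ z × y ≢ z ×
       Adj d k r c x × Adj d k r c y × Adj d k r c z ×
       ¬ Adj d k r x y × ¬ Adj d k r x z × ¬ Adj d k r y z)

-- A partition (B, R) of the vertex set given by a colouring
-- (col u = true means u ∈ B, false means u ∈ R) whose cut (set of edges
-- between B and R) is a d-cut.
IsDCutPartition : (d' d k r : ℕ) → (V k r → Bool) → Set
IsDCutPartition d' d k r col =
  (∃[ x ] col x ≡ true) × (∃[ x ] col x ≡ false) ×
  (∀ x → countV (λ u → adj d k r x u ∧ (col u xor col x)) ≤ d')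

HasDCut : (d' d k r : ℕ) → Set
HasDCut d' d k r = ∃[ col ] IsDCutPartition d' d k r col

module Submission where

-- The neighbourhood of every vertex is covered by two cliques: for t ∈ T_i, the rest of T_i
-- and its neighbours among the v's and w's (v_i if t ∈ B_i; v_{i-1} and w_i if t ∈ A_i);
-- for v_i, B_i and A_{i+1} ∪ {w_{i+1}}; for w_i, the single clique A_i ∪ {v_{i-1}}.
-- Hence no vertex is the centre of a claw.
--
-- Let (B, R) be a d-cut. If T_i contained vertices a, b of different colours, every other
-- vertex of T_i would be a neighbour across the cut of a or of b, so r ≤ 2d; hence each
-- T_i is monochromatic. Now v_i has at least d + 1 neighbours in each of B_i and A_{i+1},
-- and w_i has d + 1 in A_i, so each takes the colour of these cliques; through v_i the
-- colour of T_i passes to T_{i+1}, and going round the cycle all vertices get one colour.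

open import Defs
open import Algebra.Properties.CommutativeSemigroup using (interchange)
open import Data.Bool using (Bool; true; false; if_then_else_; _∧_; _∨_; not; _xor_; T)
open import Data.Bool.Properties
  using (_≟_; T-∧; T-∨; T-≡; T-not-≡; ¬-not; ∧-zeroʳ; ∧-identityʳ; ∨-identityʳ)
open import Data.Empty using (⊥; ⊥-elim)
open import Data.Fin using (Fin; toℕ; fromℕ; fromℕ<; inject₁) renaming (zero to fzero; suc to fsuc)
open import Data.Fin.Induction using (<-weakInduction)
open import Data.Fin.Properties
  using (toℕ-injective; toℕ<n; toℕ-fromℕ; toℕ-fromℕ<; toℕ-inject₁; suc-injective; +↔⊎; *↔×)
open import Data.Nat using (ℕ; zero; suc; _+_; _*_; _≤_; _<_; _<?_; _<ᵇ_; z≤n; s≤s)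
open import Data.Nat.Properties
  using (≡ᵇ⇒≡; ≡⇒≡ᵇ; +-commutativeSemigroup; +-comm; +-suc; +-identityʳ; +-mono-≤; +-monoʳ-≤; +-monoˡ-≤;
         ≤-refl; ≤-reflexive; ≤-trans; ≤-antisym; m≤m+n; m≤n+m; n≤1+n; ≮⇒≥; <-irrefl; <⇒≱; ≰⇒>; 0≢1+n;
         module ≤-Reasoning)
import Data.Nat.Properties as ℕ
open import Data.Nat.Tactic.RingSolver using (solve-∀)
open import Data.Product using (_×_; _,_; proj₁; proj₂; ∃-syntax)
open import Data.Sum using (_⊎_; inj₁; inj₂)
open import Data.Sum.Function.Propositional using (_⊎-↔_)
open import Function using (_∘_)
open import Function.Bundles using (Equivalence; _↔_; mk↔ₛ′)
open import Function.Properties.Inverse using (↔-trans; ↔-sym)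
open import Relation.Binary.PropositionalEquality
open import Relation.Nullary using (¬_; yes; no)

open Equivalence using (to; from)

ind : Bool → ℕ
ind b = if b then 1 else 0

ind-mono : ∀ a b → (T a → T b) → ind a ≤ ind b
ind-mono true  true  _   = ≤-refl
ind-mono true  false a⇒b = ⊥-elim (a⇒b _)
ind-mono false b     _   = z≤n

ind-+-not : ∀ b → ind b + ind (not b) ≡ 1
ind-+-not true  = refl
ind-+-not false = refl

ind-∨-disjoint : ∀ a b → (T a → T b → ⊥) → ind (a ∨ b) ≡ ind a + ind b
ind-∨-disjoint true  true  disj = ⊥-elim (disj _ _)
ind-∨-disjoint true  false disj = refl
ind-∨-disjoint false b     disj = refl

ind≤1 : ∀ b → ind b ≤ 1
ind≤1 true  = ≤-refl
ind≤1 false = z≤n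

¬T⇒≡false : ∀ {b} → ¬ T b → b ≡ false
¬T⇒≡false ¬b = ¬-not (¬b ∘ from T-≡)

T-not⇒¬T : ∀ {b} → T (not b) → ¬ T b
T-not⇒¬T {b} = subst T ∘ to (T-not-≡ {b})

∧-not-∧-disjoint : ∀ x y z → T (x ∧ not z) → T (y ∧ z) → ⊥
∧-not-∧-disjoint true  y     true  ()
∧-not-∧-disjoint false y     z     ()
∧-not-∧-disjoint true  true  false _ ()
∧-not-∧-disjoint true  false false _ ()

T-xor⇒≢ : ∀ {a b} → T (a xor b) → a ≢ b
T-xor⇒≢ {true}  {true}  () _
T-xor⇒≢ {false} {false} () _

≢⇒T-xor : ∀ {a b} → a ≢ b → T (a xor b)
≢⇒T-xor {true}  {true}  a≢b = a≢b refl
≢⇒T-xor {true}  {false} _   = _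
≢⇒T-xor {false} {true}  _   = _
≢⇒T-xor {false} {false} a≢b = a≢b refl

T-not-xor⇒≡ : ∀ {a b} → T (not (a xor b)) → a ≡ b
T-not-xor⇒≡ {true}  {true}  _ = refl
T-not-xor⇒≡ {false} {false} _ = refl

bool-pigeonhole : ∀ (a b c : Bool) → a ≡ b ⊎ a ≡ c ⊎ b ≡ c
bool-pigeonhole true  true  _     = inj₁ refl
bool-pigeonhole false false _     = inj₁ refl
bool-pigeonhole true  false true  = inj₂ (inj₁ refl)
bool-pigeonhole false true  false = inj₂ (inj₁ refl)
bool-pigeonhole true  false false = inj₂ (inj₂ refl)
bool-pigeonhole false true  true  = inj₂ (inj₂ refl)

sumFin-cong : ∀ n {f g : Fin n → ℕ} → (∀ j → f j ≡ g j) → sumFin n f ≡ sumFin n g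
sumFin-cong zero    f≗g = refl
sumFin-cong (suc n) f≗g = cong₂ _+_ (f≗g fzero) (sumFin-cong n (f≗g ∘ fsuc))

sumFin-mono : ∀ n {f g : Fin n → ℕ} → (∀ j → f j ≤ g j) → sumFin n f ≤ sumFin n g
sumFin-mono zero    f≤g = z≤n
sumFin-mono (suc n) f≤g = +-mono-≤ (f≤g fzero) (sumFin-mono n (f≤g ∘ fsuc))

sumFin-+ : ∀ n (f g : Fin n → ℕ) → sumFin n (λ j → f j + g j) ≡ sumFin n f + sumFin n g
sumFin-+ zero    f g = refl
sumFin-+ (suc n) f g = trans (cong (f fzero + g fzero +_) (sumFin-+ n (f ∘ fsuc) (g ∘ fsuc)))
                             (interchange +-commutativeSemigroup (f fzero) (g fzero) _ _)

sumFin-const-1 : ∀ n → sumFin n (λ _ → 1) ≡ n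
sumFin-const-1 zero    = refl
sumFin-const-1 (suc n) = cong suc (sumFin-const-1 n)

term≤sumFin : ∀ n (f : Fin n → ℕ) i → f i ≤ sumFin n f
term≤sumFin (suc n) f fzero    = m≤m+n _ _
term≤sumFin (suc n) f (fsuc i) = ≤-trans (term≤sumFin n (f ∘ fsuc) i) (m≤n+m _ _)

sumFin-zero : ∀ n (f : Fin n → ℕ) → (∀ j → f j ≡ 0) → sumFin n f ≡ 0
sumFin-zero zero    f f≗0 = refl
sumFin-zero (suc n) f f≗0 = cong₂ _+_ (f≗0 fzero) (sumFin-zero n (f ∘ fsuc) (f≗0 ∘ fsuc))

sumFin-delta : ∀ n (f : Fin n → ℕ) i → (∀ j → j ≢ i → f j ≡ 0) → sumFin n f ≡ f i
sumFin-delta (suc n) f fzero    f≗0 =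
  trans (cong (f fzero +_) (sumFin-zero n (f ∘ fsuc) (λ j → f≗0 (fsuc j) λ ()))) (+-identityʳ _)
sumFin-delta (suc n) f (fsuc i) f≗0 =
  cong₂ _+_ (f≗0 fzero λ ()) (sumFin-delta n (f ∘ fsuc) i (λ j j≢i → f≗0 (fsuc j) (j≢i ∘ suc-injective)))

HoldsOnlyAt : ∀ {n} → (Fin n → Bool) → Fin n → Set
HoldsOnlyAt p i = T (p i) × (∀ j → T (p j) → j ≡ i)

countFin-sumFin : ∀ n (p : Fin n → Bool) → countFin n p ≡ sumFin n (ind ∘ p)
countFin-sumFin zero    p = refl
countFin-sumFin (suc n) p = cong (ind (p fzero) +_) (countFin-sumFin n (p ∘ fsuc))

countFin-cong : ∀ n {p q : Fin n → Bool} → (∀ c → p c ≡ q c) → countFin n p ≡ countFin n q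
countFin-cong n {p} {q} p≗q = begin
  countFin n p        ≡⟨ countFin-sumFin n p ⟩
  sumFin n (ind ∘ p)  ≡⟨ sumFin-cong n (cong ind ∘ p≗q) ⟩
  sumFin n (ind ∘ q)  ≡⟨ countFin-sumFin n q ⟨
  countFin n q        ∎
  where open ≡-Reasoning

countFin-mono : ∀ n {p q : Fin n → Bool} → (∀ c → T (p c) → T (q c)) → countFin n p ≤ countFin n q
countFin-mono n {p} {q} p⇒q = subst₂ _≤_ (sym (countFin-sumFin n p)) (sym (countFin-sumFin n q))
  (sumFin-mono n (λ c → ind-mono (p c) (q c) (p⇒q c)))

countFin-false : ∀ n → countFin n (λ _ → false) ≡ 0
countFin-false zero    = refl
countFin-false (suc n) = countFin-false n

countFin-complement : ∀ n (p : Fin n → Bool) → countFin n p + countFin n (not ∘ p) ≡ n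
countFin-complement n p = begin
  countFin n p + countFin n (not ∘ p)            ≡⟨ cong₂ _+_ (countFin-sumFin n p) (countFin-sumFin n (not ∘ p)) ⟩
  sumFin n (ind ∘ p) + sumFin n (ind ∘ not ∘ p)  ≡⟨ sumFin-+ n (ind ∘ p) (ind ∘ not ∘ p) ⟨
  sumFin n (λ c → ind (p c) + ind (not (p c)))   ≡⟨ sumFin-cong n (ind-+-not ∘ p) ⟩
  sumFin n (λ _ → 1)                             ≡⟨ sumFin-const-1 n ⟩
  n                                              ∎
  where open ≡-Reasoning

countFin-∨-disjoint : ∀ n (p q : Fin n → Bool) → (∀ c → T (p c) → T (q c) → ⊥) →
  countFin n (λ c → p c ∨ q c) ≡ countFin n p + countFin n q
countFin-∨-disjoint n p q disj = begin
  countFin n (λ c → p c ∨ q c)                ≡⟨ countFin-sumFin n _ ⟩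
  sumFin n (λ c → ind (p c ∨ q c))            ≡⟨ sumFin-cong n (λ c → ind-∨-disjoint (p c) (q c) (disj c)) ⟩
  sumFin n (λ c → ind (p c) + ind (q c))      ≡⟨ sumFin-+ n (ind ∘ p) (ind ∘ q) ⟩
  sumFin n (ind ∘ p) + sumFin n (ind ∘ q)     ≡⟨ cong₂ _+_ (countFin-sumFin n p) (countFin-sumFin n q) ⟨
  countFin n p + countFin n q                 ∎
  where open ≡-Reasoning

countFin-only : ∀ n {p : Fin n → Bool} {i} → HoldsOnlyAt p i → countFin n p ≡ 1
countFin-only n {p} {i} (pi , only) = begin
  countFin n p        ≡⟨ countFin-sumFin n p ⟩
  sumFin n (ind ∘ p)  ≡⟨ sumFin-delta n (ind ∘ p) i (λ j j≢i → ind-false (j≢i ∘ only j)) ⟩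
  ind (p i)           ≡⟨ ind-true pi ⟩
  1                   ∎
  where
  open ≡-Reasoning
  ind-false : ∀ {b} → ¬ T b → ind b ≡ 0
  ind-false {true}  ¬b = ⊥-elim (¬b _)
  ind-false {false} ¬b = refl
  ind-true : ∀ {b} → T b → ind b ≡ 1
  ind-true {true} _ = refl

countFin-<ᵇ : ∀ n m → m ≤ n → countFin n (λ a → toℕ a <ᵇ m) ≡ m
countFin-<ᵇ n       zero    _         = countFin-false n
countFin-<ᵇ (suc n) (suc m) (s≤s m≤n) = cong suc (countFin-<ᵇ n m m≤n)

sumFin-countFin-only : ∀ k r {e : Fin k → Bool} {i} → HoldsOnlyAt e i → (q : Fin r → Bool) →
  sumFin k (λ j → countFin r (λ b → e j ∧ q b)) ≡ countFin r q
sumFin-countFin-only k r {e} {i} (ei , only) q = begin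
  sumFin k (λ j → row (e j))  ≡⟨ sumFin-delta k (row ∘ e) i row-off-i ⟩
  row (e i)                   ≡⟨ cong row (to T-≡ ei) ⟩
  countFin r q                ∎
  where
  open ≡-Reasoning
  row : Bool → ℕ
  row x = countFin r (λ b → x ∧ q b)
  row-off-i : ∀ j → j ≢ i → row (e j) ≡ 0
  row-off-i j j≢i = trans (cong row (¬T⇒≡false (j≢i ∘ only j))) (countFin-false r)

some-successor : ∀ {k} (i : Fin k) → ∃[ j ] T (nxt k i j)
some-successor {suc k} i with suc (toℕ i) <? suc k
... | yes 1+i<k = fromℕ< 1+i<k , from T-∨ (inj₁ (≡⇒≡ᵇ _ _ (sym (toℕ-fromℕ< 1+i<k))))
... | no  1+i≮k = fzero , from T-∧ (≡⇒≡ᵇ _ _ (≤-antisym (toℕ<n i) (≮⇒≥ 1+i≮k)) , _)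

nxt-inject₁-suc : ∀ {k} (i : Fin k) → T (nxt (suc k) (inject₁ i) (fsuc i))
nxt-inject₁-suc i = from T-∨ (inj₁ (≡⇒≡ᵇ _ _ (cong suc (toℕ-inject₁ i))))

some-predecessor : ∀ {k} (j : Fin k) → ∃[ i ] T (nxt k i j)
some-predecessor {suc k} fzero    = fromℕ k , from T-∧ (≡⇒≡ᵇ _ _ (cong suc (toℕ-fromℕ k)) , _)
some-predecessor {suc k} (fsuc j) = inject₁ j , nxt-inject₁-suc j

module _ {k : ℕ} where

  ==⇒≡ : {i j : Fin k} → T (i == j) → i ≡ j
  ==⇒≡ {i} {j} = toℕ-injective ∘ ≡ᵇ⇒≡ (toℕ i) (toℕ j)

  ≡⇒== : {i j : Fin k} → i ≡ j → T (i == j)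
  ≡⇒== {i} {j} = ≡⇒≡ᵇ (toℕ i) (toℕ j) ∘ cong toℕ

  only-==ˡ : (i : Fin k) → HoldsOnlyAt (i ==_) i
  only-==ˡ i = ≡⇒== {i} refl , λ j i==j → sym (==⇒≡ i==j)

  only-==ʳ : (i : Fin k) → HoldsOnlyAt (_== i) i
  only-==ʳ i = ≡⇒== {i} refl , λ j j==i → ==⇒≡ j==i

  nxt⇒ : {i j : Fin k} → T (nxt k i j) → suc (toℕ i) ≡ toℕ j ⊎ (suc (toℕ i) ≡ k × toℕ j ≡ 0)
  nxt⇒ {i} {j} i→j with to T-∨ i→j
  ... | inj₁ step = inj₁ (≡ᵇ⇒≡ _ _ step)
  ... | inj₂ wrap = let last , first = to T-∧ wrap in inj₂ (≡ᵇ⇒≡ _ k last , ≡ᵇ⇒≡ (toℕ j) 0 first)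

  nxt-functional : {i j j′ : Fin k} → T (nxt k i j) → T (nxt k i j′) → j ≡ j′
  nxt-functional {i = i} {j} {j′} i→j i→j′ with nxt⇒ {i} {j} i→j | nxt⇒ {i} {j′} i→j′
  ... | inj₁ e | inj₁ e′ = toℕ-injective (trans (sym e) e′)
  ... | inj₁ e | inj₂ (last , _) = ⊥-elim (<-irrefl (trans (sym e) last) (toℕ<n j))
  ... | inj₂ (last , _) | inj₁ e′ = ⊥-elim (<-irrefl (trans (sym e′) last) (toℕ<n j′))
  ... | inj₂ (_ , j≡0) | inj₂ (_ , j′≡0) = toℕ-injective (trans j≡0 (sym j′≡0))

  nxt-injective : {i i′ j : Fin k} → T (nxt k i j) → T (nxt k i′ j) → i ≡ i′
  nxt-injective {i} {i′} {j} i→j i′→j with nxt⇒ {i} {j} i→j | nxt⇒ {i′} {j} i′→j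
  ... | inj₁ e | inj₁ e′ = toℕ-injective (ℕ.suc-injective (trans e (sym e′)))
  ... | inj₁ e | inj₂ (_ , j≡0) = ⊥-elim (0≢1+n (trans (sym j≡0) (sym e)))
  ... | inj₂ (_ , j≡0) | inj₁ e′ = ⊥-elim (0≢1+n (trans (sym j≡0) (sym e′)))
  ... | inj₂ (last , _) | inj₂ (last′ , _) = toℕ-injective (ℕ.suc-injective (trans last (sym last′)))

  successor : (i : Fin k) → ∃[ j ] HoldsOnlyAt (nxt k i) j
  successor i = let j , i→j = some-successor i in j , i→j , λ j′ i→j′ → nxt-functional {i = i} i→j′ i→j

  predecessor : (j : Fin k) → ∃[ i ] HoldsOnlyAt (λ i → nxt k i j) i
  predecessor j = let i , i→j = some-predecessor j in i , i→j , λ i′ i′→j → nxt-injective {j = j} i′→j i→j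

nxt-invariant⇒constant : ∀ {k} {A : Set} (f : Fin k → A) → (∀ {i j} → T (nxt k i j) → f i ≡ f j) →
  ∀ i j → f i ≡ f j
nxt-invariant⇒constant {suc k} f step i j = trans (≡f₀ i) (sym (≡f₀ j))
  where
  ≡f₀ : ∀ i → f i ≡ f fzero
  ≡f₀ = <-weakInduction (λ i → f i ≡ f fzero) refl λ i ih → trans (sym (step (nxt-inject₁-suc i))) ih

2*d+2≡2+[d+d] : ∀ d → 2 * d + 2 ≡ 2 + (d + d)
2*d+2≡2+[d+d] = solve-∀

2+[d+d]≤⇒1+d≤ : ∀ {d r} → 2 + (d + d) ≤ r → suc d ≤ r
2+[d+d]≤⇒1+d≤ {d} = ≤-trans (s≤s (≤-trans (m≤m+n d d) (n≤1+n _)))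

module _ (d k r : ℕ) where

  -- Degrees

  countT : (V k r → Bool) → ℕ
  countT p = sumFin k (λ j → countFin r (λ b → p (t j b)))

  deg-w : suc d ≤ r → (i : Fin k) → deg d k r (w i) ≡ d + 2
  deg-w 1+d≤r i = begin
    countT (adj d k r (w i)) + countFin k (λ j → nxt k j i) + countFin k (λ _ → false)
      ≡⟨ cong₂ _+_ (cong₂ _+_ A-part (countFin-only k (proj₂ (predecessor i)))) (countFin-false k) ⟩
    suc d + 1 + 0
      ≡⟨ trans (+-identityʳ (suc d + 1)) (sym (+-suc d 1)) ⟩
    d + 2 ∎
    where
    open ≡-Reasoning
    A-part : countT (adj d k r (w i)) ≡ suc d
    A-part = trans (sumFin-countFin-only k r (only-==ˡ i) (inA d)) (countFin-<ᵇ r (suc d) 1+d≤r)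

  deg-v : (i : Fin k) → deg d k r (v i) ≡ r + 1
  deg-v i = begin
    countT (adj d k r (v i)) + countFin k (λ _ → false) + countFin k (nxt k i)
      ≡⟨ cong₂ _+_ (cong₂ _+_ T-part (countFin-false k)) (countFin-only k (proj₂ (successor i))) ⟩
    r + 0 + 1
      ≡⟨ cong (_+ 1) (+-identityʳ r) ⟩
    r + 1 ∎
    where
    open ≡-Reasoning
    B : Fin k → Fin r → Bool
    B j b = (i == j) ∧ not (inA d b)
    A : Fin k → Fin r → Bool
    A j b = nxt k i j ∧ inA d b
    T-part : countT (adj d k r (v i)) ≡ r
    T-part = begin
      sumFin k (λ j → countFin r (λ b → B j b ∨ A j b))
        ≡⟨ sumFin-cong k (λ j → countFin-∨-disjoint r (B j) (A j) λ b →
             ∧-not-∧-disjoint (i == j) (nxt k i j) (inA d b)) ⟩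
      sumFin k (λ j → countFin r (B j) + countFin r (A j))
        ≡⟨ sumFin-+ k _ _ ⟩
      sumFin k (λ j → countFin r (B j)) + sumFin k (λ j → countFin r (A j))
        ≡⟨ cong₂ _+_ (sumFin-countFin-only k r (only-==ˡ i) (not ∘ inA d)) (sumFin-countFin-only k r (proj₂ (successor i)) (inA d)) ⟩
      countFin r (not ∘ inA d) + countFin r (inA d)
        ≡⟨ +-comm _ (countFin r (inA d)) ⟩
      countFin r (inA d) + countFin r (not ∘ inA d)
        ≡⟨ countFin-complement r (inA d) ⟩
      r ∎

  deg-t : (i : Fin k) (a : Fin r) → deg d k r (t i a) ≡ r + ind (inA d a)
  deg-t i a = begin
    countT (adj d k r (t i a)) + v-part (inA d a) + w-part (inA d a)
      ≡⟨ cong₂ _+_ (cong₂ _+_ T-part (v-part≡1 (inA d a))) (w-part≡ind (inA d a)) ⟩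
    countFin r (not ∘ (a ==_)) + 1 + ind (inA d a)
      ≡⟨ cong (_+ ind (inA d a)) (trans (+-comm _ 1) clique) ⟩
    r + ind (inA d a) ∎
    where
    open ≡-Reasoning
    v-part : Bool → ℕ
    v-part α = countFin k (λ j → ((j == i) ∧ not α) ∨ (nxt k j i ∧ α))
    w-part : Bool → ℕ
    w-part α = countFin k (λ j → (j == i) ∧ α)

    T-part : countT (adj d k r (t i a)) ≡ countFin r (not ∘ (a ==_))
    T-part = sumFin-countFin-only k r (only-==ˡ i) (not ∘ (a ==_))

    clique : 1 + countFin r (not ∘ (a ==_)) ≡ r
    clique = trans (cong (_+ countFin r (not ∘ (a ==_))) (sym (countFin-only r (only-==ˡ a)))) (countFin-complement r (a ==_))

    v-part≡1 : ∀ α → v-part α ≡ 1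
    v-part≡1 true  = trans (countFin-cong k λ j → cong₂ _∨_ (∧-zeroʳ (j == i)) (∧-identityʳ (nxt k j i)))
                           (countFin-only k (proj₂ (predecessor i)))
    v-part≡1 false = trans (countFin-cong k λ j → trans (cong₂ _∨_ (∧-identityʳ (j == i)) (∧-zeroʳ (nxt k j i)))
                                                         (∨-identityʳ (j == i)))
                           (countFin-only k (only-==ʳ i))

    w-part≡ind : ∀ α → w-part α ≡ ind α
    w-part≡ind true  = trans (countFin-cong k (∧-identityʳ ∘ (_== i))) (countFin-only k (only-==ʳ i))
    w-part≡ind false = trans (countFin-cong k (∧-zeroʳ ∘ (_== i))) (countFin-false k)

  deg≤r+1 : suc d ≤ r → ∀ x → deg d k r x ≤ r + 1
  deg≤r+1 _   (t i a) = subst (_≤ r + 1) (sym (deg-t i a)) (+-monoʳ-≤ r (ind≤1 (inA d a)))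
  deg≤r+1 _   (v i)   = ≤-reflexive (deg-v i)
  deg≤r+1 1+d≤r (w i) = subst (_≤ r + 1) (sym (trans (deg-w 1+d≤r i) (+-suc d 1))) (+-monoˡ-≤ 1 1+d≤r)

  -- Claw-freeness

  t-t-adj : ∀ {i j a b} → i ≡ j → t i a ≢ t j b → Adj d k r (t i a) (t j b)
  t-t-adj {i} refl ti≢tj =
    from T-∧ (≡⇒== {i = i} refl , from T-not-≡ (¬T⇒≡false (ti≢tj ∘ cong (t i) ∘ ==⇒≡)))

  t-t-adj⇒ : ∀ {i j a b} → Adj d k r (t i a) (t j b) → i ≡ j
  t-t-adj⇒ ti~tj = ==⇒≡ (proj₁ (to T-∧ ti~tj))

  w-t-adj⇒ : ∀ {i j b} → Adj d k r (w i) (t j b) → i ≡ j × T (inA d b)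
  w-t-adj⇒ wi~tj = let i==j , b∈A = to T-∧ wi~tj in ==⇒≡ i==j , b∈A

  v-t-adj⇒ : ∀ {i j b} → Adj d k r (v i) (t j b) → (i ≡ j × T (not (inA d b))) ⊎ (T (nxt k i j) × T (inA d b))
  v-t-adj⇒ vi~tj with to T-∨ vi~tj
  ... | inj₁ in-B = let i==j , b∈B = to T-∧ in-B in inj₁ (==⇒≡ i==j , b∈B)
  ... | inj₂ in-A = inj₂ (to T-∧ in-A)

  -- side c x tells which of the two cliques covering the neighbourhood of c contains x.
  side : V k r → V k r → Bool
  side (t _ _) (t _ _) = true
  side (t _ _) _       = false
  side (v _)   (t _ b) = not (inA d b)
  side (v _)   _       = false
  side (w _)   _       = true

  unique-v-neighbour : ∀ {i a j j′} → Adj d k r (t i a) (v j) → Adj d k r (t i a) (v j′) → j ≡ j′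
  unique-v-neighbour {i} {a} {j} {j′} ti~vj ti~vj′ with v-t-adj⇒ {j} {i} {a} ti~vj | v-t-adj⇒ {j′} {i} {a} ti~vj′
  ... | inj₁ (refl , _)  | inj₁ (refl , _)  = refl
  ... | inj₂ (j→i , _)   | inj₂ (j′→i , _)  = nxt-injective {j = i} j→i j′→i
  ... | inj₁ (_ , a∈B)   | inj₂ (_ , a∈A)   = ⊥-elim (T-not⇒¬T a∈B a∈A)
  ... | inj₂ (_ , a∈A)   | inj₁ (_ , a∈B)   = ⊥-elim (T-not⇒¬T a∈B a∈A)

  v-w-adj-via-t : ∀ {i a j j′} → Adj d k r (t i a) (v j) → Adj d k r (t i a) (w j′) → Adj d k r (v j) (w j′)
  v-w-adj-via-t {i} {a} {j} {j′} ti~vj ti~wj′ with w-t-adj⇒ {j′} {i} {a} ti~wj′ | v-t-adj⇒ {j} {i} {a} ti~vj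
  ... | refl , a∈A | inj₁ (_ , a∈B) = ⊥-elim (T-not⇒¬T a∈B a∈A)
  ... | refl , _   | inj₂ (j→i , _) = j→i

  t-w-adj-via-v : ∀ {i j b j′} → Adj d k r (v i) (t j b) → Adj d k r (v i) (w j′) → not (inA d b) ≡ false →
    Adj d k r (t j b) (w j′)
  t-w-adj-via-v {i} {j} {b} {j′} vi~tj vi~wj′ b∉B with v-t-adj⇒ {i} {j} {b} vi~tj
  ... | inj₁ (_ , b∈B)   = ⊥-elim (subst T b∉B b∈B)
  ... | inj₂ (i→j , b∈A) = from T-∧ (≡⇒== {i = j′} (nxt-functional {i = i} vi~wj′ i→j) , b∈A)

  t-v-adj-via-w : ∀ {i j b j′} → Adj d k r (w i) (t j b) → Adj d k r (w i) (v j′) → Adj d k r (t j b) (v j′)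
  t-v-adj-via-w {i} {j} {b} {j′} wi~tj j′→i with w-t-adj⇒ {i} {j} {b} wi~tj
  ... | refl , b∈A = from T-∨ (inj₂ (from T-∧ (j′→i , b∈A)))

  same-side-of-t⇒adj : ∀ {i a x y} → Adj d k r (t i a) x → Adj d k r (t i a) y → x ≢ y →
    side (t i a) x ≡ side (t i a) y → Adj d k r x y
  same-side-of-t⇒adj {i} {a} {t j b} {t j′ b′} c~x c~y x≢y _ =
    t-t-adj (trans (sym (t-t-adj⇒ {i} {j} {a} {b} c~x)) (t-t-adj⇒ {i} {j′} {a} {b′} c~y)) x≢y
  same-side-of-t⇒adj {x = t _ _} {v _}   _   _   _   ()
  same-side-of-t⇒adj {x = t _ _} {w _}   _   _   _   ()
  same-side-of-t⇒adj {x = v _}   {t _ _} _   _   _   ()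
  same-side-of-t⇒adj {x = w _}   {t _ _} _   _   _   ()
  same-side-of-t⇒adj {i} {a} {v j} {v j′} c~x c~y x≢y _ = ⊥-elim (x≢y (cong v (unique-v-neighbour {i} {a} {j} {j′} c~x c~y)))
  same-side-of-t⇒adj {i} {a} {v j} {w j′} c~x c~y _   _ = v-w-adj-via-t {i} {a} {j} {j′} c~x c~y
  same-side-of-t⇒adj {i} {a} {w j} {v j′} c~x c~y _   _ = v-w-adj-via-t {i} {a} {j′} {j} c~y c~x
  same-side-of-t⇒adj {i} {a} {w j} {w j′} c~x c~y x≢y _ =
    ⊥-elim (x≢y (cong w (trans (proj₁ (w-t-adj⇒ {j} {i} {a} c~x)) (sym (proj₁ (w-t-adj⇒ {j′} {i} {a} c~y))))))

  same-side-of-v⇒adj : ∀ {i x y} → Adj d k r (v i) x → Adj d k r (v i) y → x ≢ y →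
    side (v i) x ≡ side (v i) y → Adj d k r x y
  same-side-of-v⇒adj {i} {t j b} {t j′ b′} c~x c~y x≢y s with v-t-adj⇒ {i} {j} {b} c~x | v-t-adj⇒ {i} {j′} {b′} c~y
  ... | inj₁ (refl , _)  | inj₁ (refl , _)  = t-t-adj refl x≢y
  ... | inj₂ (i→j , _)   | inj₂ (i→j′ , _)  = t-t-adj (nxt-functional {i = i} i→j i→j′) x≢y
  ... | inj₁ (_ , b∈B)   | inj₂ (_ , b′∈A)  = ⊥-elim (T-not⇒¬T (subst T s b∈B) b′∈A)
  ... | inj₂ (_ , b∈A)   | inj₁ (_ , b′∈B)  = ⊥-elim (T-not⇒¬T (subst T (sym s) b′∈B) b∈A)
  same-side-of-v⇒adj {x = v _}           ()
  same-side-of-v⇒adj {x = t _ _} {v _}   _   ()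
  same-side-of-v⇒adj {x = w _}   {v _}   _   ()
  same-side-of-v⇒adj {i} {t j b} {w j′}  c~x c~y _   s = t-w-adj-via-v {i} {j} {b} {j′} c~x c~y s
  same-side-of-v⇒adj {i} {w j} {t j′ b′} c~x c~y _   s = t-w-adj-via-v {i} {j′} {b′} {j} c~y c~x (sym s)
  same-side-of-v⇒adj {i} {w j} {w j′}    c~x c~y x≢y _ = ⊥-elim (x≢y (cong w (nxt-functional {i = i} {j} {j′} c~x c~y)))

  same-side-of-w⇒adj : ∀ {i x y} → Adj d k r (w i) x → Adj d k r (w i) y → x ≢ y → Adj d k r x y
  same-side-of-w⇒adj {i} {t j b} {t j′ b′} c~x c~y x≢y =
    t-t-adj (trans (sym (proj₁ (w-t-adj⇒ {i} {j} {b} c~x))) (proj₁ (w-t-adj⇒ {i} {j′} {b′} c~y))) x≢y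
  same-side-of-w⇒adj {x = w _}           ()
  same-side-of-w⇒adj {x = t _ _} {w _}   _   ()
  same-side-of-w⇒adj {x = v _}   {w _}   _   ()
  same-side-of-w⇒adj {i} {t j b} {v j′}  c~x c~y _   = t-v-adj-via-w {i} {j} {b} {j′} c~x c~y
  same-side-of-w⇒adj {i} {v j} {t j′ b′} c~x c~y _   = t-v-adj-via-w {i} {j′} {b′} {j} c~y c~x
  same-side-of-w⇒adj {i} {v j} {v j′}    c~x c~y x≢y = ⊥-elim (x≢y (cong v (nxt-injective {i = j} {j′} {i} c~x c~y)))

  same-side⇒adj : ∀ c {x y} → Adj d k r c x → Adj d k r c y → x ≢ y → side c x ≡ side c y → Adj d k r x y
  same-side⇒adj (t i a) = same-side-of-t⇒adj
  same-side⇒adj (v i)   = same-side-of-v⇒adj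
  same-side⇒adj (w i)   c~x c~y x≢y _ = same-side-of-w⇒adj c~x c~y x≢y

  clawFree : ClawFree d k r
  clawFree (c , x , y , z , x≢y , x≢z , y≢z , c~x , c~y , c~z , x≁y , x≁z , y≁z)
    with bool-pigeonhole (side c x) (side c y) (side c z)
  ... | inj₁ sxy        = x≁y (same-side⇒adj c c~x c~y x≢y sxy)
  ... | inj₂ (inj₁ sxz) = x≁z (same-side⇒adj c c~x c~z x≢z sxz)
  ... | inj₂ (inj₂ syz) = y≁z (same-side⇒adj c c~y c~z y≢z syz)

  -- No d-cut

  row : V k r → Fin k
  row (t i _) = i
  row (v i)   = i
  row (w i)   = i

  row≤countV : ∀ (p : V k r → Bool) j → countFin r (λ b → p (t j b)) ≤ countV p
  row≤countV p j =
    ≤-trans (term≤sumFin k (λ j → countFin r (λ b → p (t j b))) j) (≤-trans (m≤m+n _ _) (m≤m+n _ _))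

  module _ (r-large : 2 + (d + d) ≤ r) (col : V k r → Bool)
           (cross≤d : ∀ x → countV (λ u → adj d k r x u ∧ (col u xor col x)) ≤ d) where

    cross-row≤d : ∀ x j (p : Fin r → Bool) → (∀ b → T (p b) → Adj d k r x (t j b) × col (t j b) ≢ col x) →
      countFin r p ≤ d
    cross-row≤d x j p cross = begin
      countFin r p                          ≤⟨ countFin-mono r to-cross ⟩
      countFin r (λ b → across (t j b))     ≤⟨ row≤countV across j ⟩
      countV across                         ≤⟨ cross≤d x ⟩
      d                                     ∎
      where
      open ≤-Reasoning
      across : V k r → Bool
      across u = adj d k r x u ∧ (col u xor col x)
      to-cross : ∀ b → T (p b) → T (across (t j b))
      to-cross b pb = let x~tb , col≢ = cross b pb in from T-∧ (x~tb , ≢⇒T-xor col≢)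

    clique-monochromatic : ∀ i a b → col (t i a) ≡ col (t i b)
    clique-monochromatic i a b with col (t i a) ≟ col (t i b)
    ... | yes same = same
    ... | no  diff = ⊥-elim (<⇒≱ (≤-trans (n≤1+n _) r-large)
                       (subst (_≤ d + d) (countFin-complement r differs) (+-mono-≤ away-from-a away-from-b)))
      where
      differs : Fin r → Bool
      differs c = col (t i c) xor col (t i a)
      away-from-a : countFin r differs ≤ d
      away-from-a = cross-row≤d (t i a) i differs λ c c-differs →
        let c≠a = T-xor⇒≢ {col (t i c)} c-differs
        in t-t-adj {i} {i} {a} {c} refl (c≠a ∘ sym ∘ cong col) , c≠a
      away-from-b : countFin r (not ∘ differs) ≤ d
      away-from-b = cross-row≤d (t i b) i (not ∘ differs) λ c c=a →
        let c≠b = λ c=b → diff (trans (sym (T-not-xor⇒≡ c=a)) c=b)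
        in t-t-adj {i} {i} {b} {c} refl (c≠b ∘ sym ∘ cong col) , c≠b

    A-fits : suc d ≤ r
    A-fits = 2+[d+d]≤⇒1+d≤ r-large

    A-large : d < countFin r (inA d)
    A-large = subst (d <_) (sym (countFin-<ᵇ r (suc d) A-fits)) ≤-refl

    B-large : d < countFin r (not ∘ inA d)
    B-large = ≰⇒> λ B≤d → <⇒≱ r-large (begin
      r                                              ≡⟨ countFin-complement r (inA d) ⟨
      countFin r (inA d) + countFin r (not ∘ inA d)  ≤⟨ +-mono-≤ (≤-reflexive (countFin-<ᵇ r (suc d) A-fits)) B≤d ⟩
      suc d + d                                      ∎)
      where open ≤-Reasoning

    many-neighbours⇒same-colour : ∀ x j (p : Fin r → Bool) → d < countFin r p →
      (∀ b → T (p b) → Adj d k r x (t j b)) → ∀ a → col x ≡ col (t j a)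
    many-neighbours⇒same-colour x j p many x~p a with col x ≟ col (t j a)
    ... | yes same = same
    ... | no  diff = ⊥-elim (<⇒≱ many (cross-row≤d x j p λ b pb →
                       x~p b pb , λ e → diff (trans (sym e) (clique-monochromatic j b a))))

    v-colour-own-row : ∀ i a → col (v i) ≡ col (t i a)
    v-colour-own-row i = many-neighbours⇒same-colour (v i) i (not ∘ inA d) B-large λ b b∈B →
      from T-∨ (inj₁ (from T-∧ (≡⇒== {i = i} refl , b∈B)))

    v-colour-next-row : ∀ {i j} → T (nxt k i j) → ∀ a → col (v i) ≡ col (t j a)
    v-colour-next-row {i} {j} i→j = many-neighbours⇒same-colour (v i) j (inA d) A-large λ b b∈A →
      from T-∨ (inj₂ (from T-∧ (i→j , b∈A)))

    w-colour-own-row : ∀ i a → col (w i) ≡ col (t i a)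
    w-colour-own-row i = many-neighbours⇒same-colour (w i) i (inA d) A-large λ b b∈A →
      from T-∧ (≡⇒== {i = i} refl , b∈A)

    colour-by-row : ∀ a u → col u ≡ col (t (row u) a)
    colour-by-row a (t i b) = clique-monochromatic i b a
    colour-by-row a (v i)   = v-colour-own-row i a
    colour-by-row a (w i)   = w-colour-own-row i a

    monochromatic : ∀ u u′ → col u ≡ col u′
    monochromatic u u′ = begin
      col u                ≡⟨ colour-by-row a₀ u ⟩
      col (t (row u) a₀)   ≡⟨ nxt-invariant⇒constant (λ i → col (t i a₀)) next-row (row u) (row u′) ⟩
      col (t (row u′) a₀)  ≡⟨ colour-by-row a₀ u′ ⟨
      col u′               ∎
      where
      open ≡-Reasoning
      a₀ : Fin r
      a₀ = fromℕ< (≤-trans (s≤s z≤n) r-large)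
      next-row : ∀ {i j} → T (nxt k i j) → col (t i a₀) ≡ col (t j a₀)
      next-row {i} i→j = trans (sym (v-colour-own-row i a₀)) (v-colour-next-row i→j a₀)

  noDCut : 2 + (d + d) ≤ r → ¬ HasDCut d d k r
  noDCut r-large (col , (x , x-blue) , (y , y-red) , cross≤d) =
    true≢false (trans (sym x-blue) (trans (monochromatic r-large col cross≤d x y) y-red))
    where
    true≢false : true ≢ false
    true≢false ()

V↔⊎ : ∀ {k r} → V k r ↔ ((Fin k × Fin r) ⊎ (Fin k ⊎ Fin k))
V↔⊎ {k} {r} = mk↔ₛ′ encode decode encode∘decode decode∘encode
  where
  encode : V k r → (Fin k × Fin r) ⊎ (Fin k ⊎ Fin k)
  encode (t i a) = inj₁ (i , a)
  encode (v i)   = inj₂ (inj₁ i)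
  encode (w i)   = inj₂ (inj₂ i)
  decode : (Fin k × Fin r) ⊎ (Fin k ⊎ Fin k) → V k r
  decode (inj₁ (i , a))  = t i a
  decode (inj₂ (inj₁ i)) = v i
  decode (inj₂ (inj₂ i)) = w i
  encode∘decode : ∀ x → encode (decode x) ≡ x
  encode∘decode (inj₁ _)        = refl
  encode∘decode (inj₂ (inj₁ _)) = refl
  encode∘decode (inj₂ (inj₂ _)) = refl
  decode∘encode : ∀ u → decode (encode u) ≡ u
  decode∘encode (t _ _) = refl
  decode∘encode (v _)   = refl
  decode∘encode (w _)   = refl

k*r+[k+k]≡[r+2]*k : ∀ k r → k * r + (k + k) ≡ (r + 2) * k
k*r+[k+k]≡[r+2]*k = solve-∀

V↔Fin : ∀ k r → V k r ↔ Fin ((r + 2) * k)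
V↔Fin k r = subst (λ n → V k r ↔ Fin n) (k*r+[k+k]≡[r+2]*k k r)
  (↔-trans V↔⊎ (↔-sym (↔-trans +↔⊎ (*↔× ⊎-↔ +↔⊎))))

lemma4p2 : (d k r : ℕ) → 2 ≤ d → 2 ≤ k → 2 * d + 2 ≤ r →
    ClawFree d k r
    × ((∀ x → deg d k r x ≤ r + 1) × (∃[ x ] deg d k r x ≡ r + 1))
    × (V k r ↔ Fin ((r + 2) * k))
    × ¬ HasDCut d d k r
    × (∀ i → deg d k r (w i) ≡ d + 2)
    × (∀ i → r ≤ deg d k r (v i))
    × (∀ i a → r ≤ deg d k r (t i a))
lemma4p2 d k r _ (s≤s _) 2d+2≤r =
  clawFree d k r ,
  (deg≤r+1 d k r 1+d≤r , v fzero , deg-v d k r fzero) ,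
  V↔Fin k r ,
  noDCut d k r r-large ,
  deg-w d k r 1+d≤r ,
  (λ i → ≤-trans (m≤m+n r 1) (≤-reflexive (sym (deg-v d k r i)))) ,
  (λ i a → ≤-trans (m≤m+n r _) (≤-reflexive (sym (deg-t d k r i a))))
  where
  r-large : 2 + (d + d) ≤ r
  r-large = subst (_≤ r) (2*d+2≡2+[d+d] d) 2d+2≤r
  1+d≤r : suc d ≤ r
  1+d≤r = 2+[d+d]≤⇒1+d≤ r-large
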